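{- In $AQ_4$, each of the following vertex sets is a nontrivial block: $\Delta=\{0000,0100\}$; $\Delta'=\{0000,0100,0011,0111\}$; $\Delta''=\{0000,0100,0011,0111,1001,1010,1101,1110\}$.
   Context: $AQ_4$ is the graph with vertex set $\mathbb{Z}_2^4$ (vectors written as bit strings) in which $x,y$ are adjacent iff $x+y\in S$, where $S=\{1000,0100,0010,0001,0011,0111,1111\}$. A block of a vertex-transitive graph $X$ is a subset $\Delta$ of vertices such that for every $g\in\mathrm{Aut}(X)$ either $\Delta^g=\Delta$ or $\Delta^g\cap\Delta=\emptyset$; it is nontrivial if $1<|\Delta|<|V(X)|$. -}

module Defs where

open import Data.Bool using (Bool; true; false; _xor_)
open import Data.Vec using (Vec; []; _∷_; zipWith)
open import Data.List using (List; []; _∷_; length)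
open import Data.List.Membership.Propositional using (_∈_; _∉_)
open import Data.List.Relation.Unary.Unique.Propositional using (Unique)
open import Data.Nat using (ℕ; _<_)
open import Data.Product using (Σ; _×_; ∃; _,_)
open import Data.Sum using (_⊎_)
open import Relation.Binary.PropositionalEquality using (_≡_)
open import Function.Bundles using (_⇔_)

-- Vertices of AQ_4: elements of Z_2^4, bit strings b1 b2 b3 b4.
V : Set
V = Vec Bool 4

_⊕_ : V → V → V
_⊕_ = zipWith _xor_

S : List V
S = (true  ∷ false ∷ false ∷ false ∷ [])
  ∷ (false ∷ true  ∷ false ∷ false ∷ [])
  ∷ (false ∷ false ∷ true  ∷ false ∷ [])
  ∷ (false ∷ false ∷ false ∷ true  ∷ [])
  ∷ (false ∷ false ∷ true  ∷ true  ∷ [])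
  ∷ (false ∷ true  ∷ true  ∷ true  ∷ [])
  ∷ (true  ∷ true  ∷ true  ∷ true  ∷ [])
  ∷ []

Adj : V → V → Set
Adj x y = (x ⊕ y) ∈ S

record Aut : Set where
  field
    to      : V → V
    from    : V → V
    to-from : ∀ x → to (from x) ≡ x
    from-to : ∀ x → from (to x) ≡ x
    adj     : ∀ x y → Adj x y ⇔ Adj (to x) (to y)

open Aut public

-- A vertex subset, given as a duplicate-free list.
-- Image Δ^g equals Δ (as sets).
ImageEq : Aut → List V → Set
ImageEq g Δ = (∀ x → x ∈ Δ → to g x ∈ Δ) × (∀ y → y ∈ Δ → ∃ λ x → x ∈ Δ × to g x ≡ y)

ImageDisjoint : Aut → List V → Set
ImageDisjoint g Δ = ∀ x → x ∈ Δ → to g x ∉ Δ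

IsBlock : List V → Set
IsBlock Δ = ∀ (g : Aut) → ImageEq g Δ ⊎ ImageDisjoint g Δ

IsNontrivialBlock : List V → Set
IsNontrivialBlock Δ = Unique Δ × 1 < length Δ × length Δ < 16 × IsBlock Δ

Δ₁ Δ₂ Δ₃ : List V
Δ₁ = (false ∷ false ∷ false ∷ false ∷ [])
   ∷ (false ∷ true  ∷ false ∷ false ∷ [])
   ∷ []
Δ₂ = (false ∷ false ∷ false ∷ false ∷ [])
   ∷ (false ∷ true  ∷ false ∷ false ∷ [])
   ∷ (false ∷ false ∷ true  ∷ true  ∷ [])
   ∷ (false ∷ true  ∷ true  ∷ true  ∷ [])
   ∷ []
Δ₃ = (false ∷ false ∷ false ∷ false ∷ [])
   ∷ (false ∷ true  ∷ false ∷ false ∷ [])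
   ∷ (false ∷ false ∷ true  ∷ true  ∷ [])
   ∷ (false ∷ true  ∷ true  ∷ true  ∷ [])
   ∷ (true  ∷ false ∷ false ∷ true  ∷ [])
   ∷ (true  ∷ false ∷ true  ∷ false ∷ [])
   ∷ (true  ∷ true  ∷ false ∷ true  ∷ [])
   ∷ (true  ∷ true  ∷ true  ∷ false ∷ [])
   ∷ []

module Submission where

-- The three sets are subgroups of Z₂⁴ = V(AQ₄), but a block must be
-- preserved by *every* automorphism, not just by translations.  The proof
-- therefore characterises each set intrinsically, by graph-theoretic
-- relations that every automorphism preserves:
--
--   * a /strong edge/ is an edge whose ends have at least three common
--     neighbours; in AQ₄ these are exactly the pairs differing by 0011 or 0111;
--   * Δ  is the set of vertices reachable from 0000 by two strong edges;
--   * Δ' adds the vertices reachable by one strong edge;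
--   * Δ'' adds the non-neighbours sharing fewer than three neighbours.
--
-- General part: relations built from adjacency, equality, negation,
-- union, intersection and composition are automorphism-invariant, and any
-- set that is a class of an invariant relation (from each of its points the
-- relation reaches exactly the set) is a block.  Since translations are
-- automorphisms, "at least three common neighbours" depends only on the
-- difference x ⊕ y; a table of these differences is verified once by
-- exhaustive search, which makes all relations cheaply decidable.  The
-- theorem then reduces to finite checks that each set is a class of its
-- relation, decided by exhaustive search over the sixteen vertices.

open import Defs

open import Data.Bool as Bool using (Bool; true; false)
open import Data.Bool.Properties using (xor-assoc; xor-comm; xor-identityˡ; xor-identityʳ; xor-same)
open import Data.Vec using (Vec; []; _∷_; replicate)
open import Data.Vec.Properties using (≡-dec; zipWith-assoc; zipWith-comm; zipWith-identityˡ; zipWith-identityʳ)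
open import Data.List using (List; []; _∷_; length)
open import Data.List.Membership.Propositional using (_∈_; find; lose)
open import Data.List.Relation.Unary.All as All using (All; all?)
open import Data.List.Relation.Unary.Any using (any?)
open import Data.Nat using (zero; suc)
open import Data.Nat.Properties using (_<?_)
open import Data.Product using (_×_; ∃; _,_; proj₁; proj₂)
open import Data.Sum using (_⊎_; inj₁; inj₂)
open import Function.Bundles using (mk⇔; Equivalence)
open import Relation.Binary.Definitions using (Decidable; DecidableEquality)
open import Relation.Binary.Construct.Union using (_∪_)
open import Relation.Binary.Construct.Intersection using (_∩_)
import Relation.Binary.Construct.Union as Union
import Relation.Binary.Construct.Intersection as Intersection
open import Relation.Binary.PropositionalEquality using (_≡_; _≢_; refl; sym; cong; subst; subst₂; module ≡-Reasoning)
open ≡-Reasoning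
open import Relation.Nullary using (¬_; Dec; yes; no)
open import Relation.Nullary.Decidable using (map′; from-yes; ¬?; _×-dec_; _⊎-dec_; _→-dec_)

_≟_ : DecidableEquality V
_≟_ = ≡-dec Bool._≟_

open import Data.List.Membership.DecPropositional _≟_ using (_∈?_)
open import Data.List.Relation.Unary.Unique.DecPropositional _≟_ using (unique?)

∃-bits? : ∀ {n} {P : Vec Bool n → Set} → (∀ v → Dec (P v)) → Dec (∃ P)
∃-bits? {zero}  P? = map′ ([] ,_) (λ { ([] , p) → p }) (P? [])
∃-bits? {suc n} {P} P? =
  map′ join split (∃-bits? (λ v → P? (false ∷ v)) ⊎-dec ∃-bits? (λ v → P? (true ∷ v)))
  where
  join : (∃ λ v → P (false ∷ v)) ⊎ (∃ λ v → P (true ∷ v)) → ∃ P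
  join (inj₁ (v , p)) = false ∷ v , p
  join (inj₂ (v , p)) = true ∷ v , p
  split : ∃ P → (∃ λ v → P (false ∷ v)) ⊎ (∃ λ v → P (true ∷ v))
  split (false ∷ v , p) = inj₁ (v , p)
  split (true ∷ v , p) = inj₂ (v , p)

∀-bits? : ∀ {n} {P : Vec Bool n → Set} → (∀ v → Dec (P v)) → Dec (∀ v → P v)
∀-bits? {zero}  P? = map′ (λ { p [] → p }) (λ f → f []) (P? [])
∀-bits? {suc n} P? =
  map′ (λ { (f , t) (false ∷ v) → f v ; (f , t) (true ∷ v) → t v })
       (λ h → (λ v → h (false ∷ v)) , (λ v → h (true ∷ v)))
       (∀-bits? (λ v → P? (false ∷ v)) ×-dec ∀-bits? (λ v → P? (true ∷ v)))

𝟘 : V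
𝟘 = replicate 4 false

⊕-assoc : ∀ x y z → (x ⊕ y) ⊕ z ≡ x ⊕ (y ⊕ z)
⊕-assoc = zipWith-assoc xor-assoc

⊕-comm : ∀ x y → x ⊕ y ≡ y ⊕ x
⊕-comm = zipWith-comm xor-comm

⊕-identityˡ : ∀ x → 𝟘 ⊕ x ≡ x
⊕-identityˡ = zipWith-identityˡ xor-identityˡ

⊕-identityʳ : ∀ x → x ⊕ 𝟘 ≡ x
⊕-identityʳ = zipWith-identityʳ xor-identityʳ

⊕-self : ∀ x → x ⊕ x ≡ 𝟘
⊕-self (a ∷ b ∷ c ∷ d ∷ []) rewrite xor-same a | xor-same b | xor-same c | xor-same d = refl

⊕-cancelˡ : ∀ x y → x ⊕ (x ⊕ y) ≡ y
⊕-cancelˡ x y = begin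
  x ⊕ (x ⊕ y)  ≡⟨ sym (⊕-assoc x x y) ⟩
  (x ⊕ x) ⊕ y  ≡⟨ cong (_⊕ y) (⊕-self x) ⟩
  𝟘 ⊕ y        ≡⟨ ⊕-identityˡ y ⟩
  y            ∎

⊕-translate : ∀ x u v → (x ⊕ u) ⊕ (x ⊕ v) ≡ u ⊕ v
⊕-translate x u v = begin
  (x ⊕ u) ⊕ (x ⊕ v)  ≡⟨ cong (_⊕ (x ⊕ v)) (⊕-comm x u) ⟩
  (u ⊕ x) ⊕ (x ⊕ v)  ≡⟨ ⊕-assoc u x (x ⊕ v) ⟩
  u ⊕ (x ⊕ (x ⊕ v))  ≡⟨ cong (u ⊕_) (⊕-cancelˡ x v) ⟩
  u ⊕ v              ∎

_⁻¹ : Aut → Aut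
g ⁻¹ = record
  { to = from g ; from = to g ; to-from = from-to g ; from-to = to-from g
  ; adj = λ x y → mk⇔ (back x y) (forth x y) }
  where
  back : ∀ x y → Adj x y → Adj (from g x) (from g y)
  back x y a = Equivalence.from (adj g (from g x) (from g y))
                 (subst₂ Adj (sym (to-from g x)) (sym (to-from g y)) a)
  forth : ∀ x y → Adj (from g x) (from g y) → Adj x y
  forth x y a = subst₂ Adj (to-from g x) (to-from g y)
                  (Equivalence.to (adj g (from g x) (from g y)) a)

Invariant : (V → V → Set) → Set
Invariant R = ∀ g {x y} → R x y → R (to g x) (to g y)

reflect : ∀ {R} → Invariant R → ∀ g {x y} → R (to g x) (to g y) → R x y
reflect {R} R-inv g {x} {y} r =
  subst₂ R (from-to g x) (from-to g y) (R-inv (g ⁻¹) r)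

≡-invariant : Invariant _≡_
≡-invariant g = cong (to g)

Adj-invariant : Invariant Adj
Adj-invariant g {x} {y} = Equivalence.to (adj g x y)

¬-invariant : ∀ {R} → Invariant R → Invariant (λ x y → ¬ R x y)
¬-invariant R-inv g ¬r r = ¬r (reflect R-inv g r)

∪-invariant : ∀ {R Q} → Invariant R → Invariant Q → Invariant (R ∪ Q)
∪-invariant R-inv Q-inv g (inj₁ r) = inj₁ (R-inv g r)
∪-invariant R-inv Q-inv g (inj₂ q) = inj₂ (Q-inv g q)

∩-invariant : ∀ {R Q} → Invariant R → Invariant Q → Invariant (R ∩ Q)
∩-invariant R-inv Q-inv g (r , q) = R-inv g r , Q-inv g q

_⨾_ : (V → V → Set) → (V → V → Set) → V → V → Set
(R ⨾ Q) x y = ∃ λ z → R x z × Q z y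

⨾-invariant : ∀ {R Q} → Invariant R → Invariant Q → Invariant (R ⨾ Q)
⨾-invariant R-inv Q-inv g (z , r , q) = to g z , R-inv g r , Q-inv g q

⨾-decidable : ∀ {R Q} → Decidable R → Decidable Q → Decidable (R ⨾ Q)
⨾-decidable R? Q? x y = ∃-bits? (λ z → R? x z ×-dec Q? z y)

-- AQ₄ is a Cayley graph of Z₂⁴, so each translation v ↦ x ⊕ v is an automorphism.
translation : V → Aut
translation x = record
  { to = x ⊕_ ; from = x ⊕_ ; to-from = ⊕-cancelˡ x ; from-to = ⊕-cancelˡ x
  ; adj = λ u v → mk⇔ (subst (_∈ S) (sym (⊕-translate x u v)))
                      (subst (_∈ S) (⊕-translate x u v)) }

difference⇔ : ∀ {R} → Invariant R → ∀ x y → (R x y → R 𝟘 (x ⊕ y)) × (R 𝟘 (x ⊕ y) → R x y)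
difference⇔ {R} R-inv x y =
  (λ r → subst (λ u → R u (x ⊕ y)) (⊕-self x) (R-inv (translation x) r)) ,
  (λ r → subst₂ R (⊕-identityʳ x) (⊕-cancelˡ x y) (R-inv (translation x) r))

Adj? : Decidable Adj
Adj? x y = (x ⊕ y) ∈? S

CommonNeighbour : V → V → V → Set
CommonNeighbour x y z = Adj x z × Adj y z

ThreeCommonNeighbours : V → V → Set
ThreeCommonNeighbours x y =
  ∃ λ z₁ → CommonNeighbour x y z₁ ×
  ∃ λ z₂ → CommonNeighbour x y z₂ × z₁ ≢ z₂ ×
  ∃ λ z₃ → CommonNeighbour x y z₃ × z₁ ≢ z₃ × z₂ ≢ z₃

ThreeCommonNeighbours-invariant : Invariant ThreeCommonNeighbours
ThreeCommonNeighbours-invariant g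
  (z₁ , c₁ , z₂ , c₂ , d₁₂ , z₃ , c₃ , d₁₃ , d₂₃) =
  to g z₁ , common c₁ , to g z₂ , common c₂ , distinct d₁₂ ,
  to g z₃ , common c₃ , distinct d₁₃ , distinct d₂₃
  where
  common : ∀ {x y z} → CommonNeighbour x y z → CommonNeighbour (to g x) (to g y) (to g z)
  common (a , b) = Adj-invariant g a , Adj-invariant g b
  distinct : ∀ {z w} → z ≢ w → to g z ≢ to g w
  distinct = ¬-invariant ≡-invariant g

search-ThreeCommonNeighbours : Decidable ThreeCommonNeighbours
search-ThreeCommonNeighbours x y =
  ∃-bits? λ z₁ → common? z₁ ×-dec
  ∃-bits? λ z₂ → common? z₂ ×-dec ¬? (z₁ ≟ z₂) ×-dec
  ∃-bits? λ z₃ → common? z₃ ×-dec ¬? (z₁ ≟ z₃) ×-dec ¬? (z₂ ≟ z₃)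
  where
  common? : ∀ z → Dec (CommonNeighbour x y z)
  common? z = Adj? x z ×-dec Adj? y z

-- The differences x ⊕ y for which x and y have at least three common
-- neighbours (seven for 0000, four for the others; all remaining differences
-- give exactly two).
D₃ : List V
D₃ = (false ∷ false ∷ false ∷ false ∷ [])
   ∷ (false ∷ false ∷ true  ∷ true  ∷ [])
   ∷ (false ∷ true  ∷ false ∷ true  ∷ [])
   ∷ (false ∷ true  ∷ true  ∷ false ∷ [])
   ∷ (false ∷ true  ∷ true  ∷ true  ∷ [])
   ∷ (true  ∷ false ∷ true  ∷ true  ∷ [])
   ∷ (true  ∷ true  ∷ false ∷ false ∷ [])
   ∷ []

D₃-correct : ∀ d → (ThreeCommonNeighbours 𝟘 d → d ∈ D₃) × (d ∈ D₃ → ThreeCommonNeighbours 𝟘 d)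
D₃-correct = from-yes (∀-bits? λ d →
  (search-ThreeCommonNeighbours 𝟘 d →-dec d ∈? D₃) ×-dec (d ∈? D₃ →-dec search-ThreeCommonNeighbours 𝟘 d))

ThreeCommonNeighbours? : Decidable ThreeCommonNeighbours
ThreeCommonNeighbours? x y =
  map′ (λ d∈D₃ → proj₂ difference (proj₂ (D₃-correct (x ⊕ y)) d∈D₃))
       (λ three → proj₁ (D₃-correct (x ⊕ y)) (proj₁ difference three))
       ((x ⊕ y) ∈? D₃)
  where
  difference : (ThreeCommonNeighbours x y → ThreeCommonNeighbours 𝟘 (x ⊕ y)) ×
               (ThreeCommonNeighbours 𝟘 (x ⊕ y) → ThreeCommonNeighbours x y)
  difference = difference⇔ ThreeCommonNeighbours-invariant x y

-- A strong edge is an edge lying in at least three triangles; in AQ₄ these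
-- are the pairs differing by 0011 or 0111.
StrongEdge : V → V → Set
StrongEdge = Adj ∩ ThreeCommonNeighbours

StrongEdge-invariant : Invariant StrongEdge
StrongEdge-invariant = ∩-invariant Adj-invariant ThreeCommonNeighbours-invariant

StrongEdge? : Decidable StrongEdge
StrongEdge? = Intersection.decidable Adj? ThreeCommonNeighbours?

IsClassOf : (V → V → Set) → List V → Set
IsClassOf R Δ = ∀ {x} → x ∈ Δ → ∀ y → (y ∈ Δ → R x y) × (R x y → y ∈ Δ)

IsClassOf? : ∀ {R} → Decidable R → ∀ Δ → Dec (IsClassOf R Δ)
IsClassOf? R? Δ =
  map′ (λ all x∈Δ → All.lookup all x∈Δ) (λ cls → All.tabulate cls)
       (all? (λ x → ∀-bits? (λ y → ((y ∈? Δ) →-dec R? x y) ×-dec (R? x y →-dec (y ∈? Δ)))) Δ)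

-- An automorphism g that maps one point x₀ of a class Δ of an invariant
-- relation into Δ maps Δ onto itself: invariance carries "R x₀ ⋯" to
-- "R (g x₀) ⋯" (so g maps Δ into Δ), and g⁻¹ carries it back (so onto).
meets⇒ImageEq : ∀ {R Δ} → Invariant R → IsClassOf R Δ →
                ∀ g {x₀} → x₀ ∈ Δ → to g x₀ ∈ Δ → ImageEq g Δ
meets⇒ImageEq {R} {Δ} R-inv class g {x₀} x₀∈Δ gx₀∈Δ = into , onto
  where
  into : ∀ x → x ∈ Δ → to g x ∈ Δ
  into x x∈Δ = proj₂ (class gx₀∈Δ (to g x)) (R-inv g (proj₁ (class x₀∈Δ x) x∈Δ))
  onto : ∀ y → y ∈ Δ → ∃ λ x → x ∈ Δ × to g x ≡ y
  onto y y∈Δ = from g y , proj₂ (class x₀∈Δ (from g y)) R-x₀-g⁻¹y , to-from g y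
    where
    R-x₀-g⁻¹y : R x₀ (from g y)
    R-x₀-g⁻¹y = reflect R-inv g
      (subst (R (to g x₀)) (sym (to-from g y)) (proj₁ (class gx₀∈Δ y) y∈Δ))

class⇒block : ∀ {R Δ} → Invariant R → IsClassOf R Δ → IsBlock Δ
class⇒block {Δ = Δ} R-inv class g with any? (λ x → to g x ∈? Δ) Δ
... | no  misses = inj₂ λ x x∈Δ gx∈Δ → misses (lose x∈Δ gx∈Δ)
... | yes meets  with find meets
...   | x₀ , x₀∈Δ , gx₀∈Δ = inj₁ (meets⇒ImageEq R-inv class g x₀∈Δ gx₀∈Δ)

-- The relations characterising the three blocks (as classes through 0000):
-- Rel₁ x y: y is two strong edges away from x   (Δ  = {0000,0100});
-- Rel₂ x y: additionally, one strong edge away   (Δ' = Δ ∪ {0011,0111});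
-- Rel₃ x y: additionally, x and y are non-adjacent with fewer than three
--           common neighbours                    (Δ'' = Δ' ∪ {1001,1010,1101,1110}).
Rel₁ Rel₂ Rel₃ : V → V → Set
Rel₁ = StrongEdge ⨾ StrongEdge
Rel₂ = Rel₁ ∪ StrongEdge
Rel₃ = Rel₂ ∪ ((λ x y → ¬ Adj x y) ∩ (λ x y → ¬ ThreeCommonNeighbours x y))

Rel₁-invariant : Invariant Rel₁
Rel₁-invariant = ⨾-invariant StrongEdge-invariant StrongEdge-invariant

Rel₂-invariant : Invariant Rel₂
Rel₂-invariant = ∪-invariant Rel₁-invariant StrongEdge-invariant

Rel₃-invariant : Invariant Rel₃
Rel₃-invariant = ∪-invariant Rel₂-invariant
  (∩-invariant (¬-invariant Adj-invariant) (¬-invariant ThreeCommonNeighbours-invariant))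

Rel₁? : Decidable Rel₁
Rel₁? = ⨾-decidable StrongEdge? StrongEdge?

Rel₂? : Decidable Rel₂
Rel₂? = Union.decidable Rel₁? StrongEdge?

Rel₃? : Decidable Rel₃
Rel₃? = Union.decidable Rel₂?
  (Intersection.decidable (λ x y → ¬? (Adj? x y)) (λ x y → ¬? (ThreeCommonNeighbours? x y)))

mainTheorem12 : IsNontrivialBlock Δ₁ × IsNontrivialBlock Δ₂ × IsNontrivialBlock Δ₃
mainTheorem12 = block₁ , block₂ , block₃
  where
  block₁ : IsNontrivialBlock Δ₁
  block₁ = from-yes (unique? Δ₁) , from-yes (1 <? length Δ₁) , from-yes (length Δ₁ <? 16) ,
           class⇒block Rel₁-invariant (from-yes (IsClassOf? Rel₁? Δ₁))
  block₂ : IsNontrivialBlock Δ₂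
  block₂ = from-yes (unique? Δ₂) , from-yes (1 <? length Δ₂) , from-yes (length Δ₂ <? 16) ,
           class⇒block Rel₂-invariant (from-yes (IsClassOf? Rel₂? Δ₂))
  block₃ : IsNontrivialBlock Δ₃
  block₃ = from-yes (unique? Δ₃) , from-yes (1 <? length Δ₃) , from-yes (length Δ₃ <? 16) ,
           class⇒block Rel₃-invariant (from-yes (IsClassOf? Rel₃? Δ₃))
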